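{- For every integer $d \geq 3$, the complete bipartite graph $K_{2,d}$ satisfies $\chi'_{st}(K_{2,d}) = 2d - \left\lfloor \frac{d}{2} \right\rfloor$.
   Context: A star edge coloring of a graph is a proper edge coloring in which there is no path or cycle of length four (i.e., with four edges) whose edges use only two colors. The star chromatic index $\chi'_{st}(G)$ is the minimum number $t$ such that $G$ has a star edge coloring with $t$ colors. -}

module Defs where

open import Data.Nat using (ℕ; _+_; _<_; _≤_)
open import Data.Fin using (Fin; toℕ)
open import Data.Product using (Σ; _×_; ∃; ∃-syntax)
open import Data.Sum using (_⊎_)
open import Relation.Binary.PropositionalEquality using (_≡_; _≢_)
open import Data.Empty using (⊥)

record Graph : Set₁ where
  field
    n       : ℕ
    Adj     : Fin n → Fin n → Set
    Adj-sym : ∀ {u v} → Adj u v → Adj v u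
    Adj-irr : ∀ {u} → Adj u u → ⊥
open Graph public

KAdj : (m k : ℕ) → Fin (m + k) → Fin (m + k) → Set
KAdj m k u v = (toℕ u < m × m ≤ toℕ v) ⊎ (m ≤ toℕ u × toℕ v < m)

open import Data.Sum using (inj₁; inj₂)
open import Data.Product using (_,_)
open import Data.Nat.Properties using (<-≤-trans; <-irrefl)
open import Relation.Binary.PropositionalEquality using (refl)

KAdj-sym : ∀ m k {u v} → KAdj m k u v → KAdj m k v u
KAdj-sym m k (inj₁ (p , q)) = inj₂ (q , p)
KAdj-sym m k (inj₂ (p , q)) = inj₁ (q , p)

KAdj-irr : ∀ m k {u} → KAdj m k u u → ⊥
KAdj-irr m k (inj₁ (p , q)) = <-irrefl refl (<-≤-trans p q)
KAdj-irr m k (inj₂ (p , q)) = <-irrefl refl (<-≤-trans q p)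

K : ℕ → ℕ → Graph
K m k = record { n = m + k ; Adj = KAdj m k ; Adj-sym = KAdj-sym m k ; Adj-irr = KAdj-irr m k }

-- An edge colouring with t colours: the colour of edge uv is c u v
-- (values on non-adjacent pairs are irrelevant), symmetric on edges.
module _ (G : Graph) (t : ℕ) where
  private
    V = Fin (n G)
    _~_ = Adj G

  IsEdgeColouring : (V → V → Fin t) → Set
  IsEdgeColouring c = ∀ u v → u ~ v → c u v ≡ c v u

  IsProper : (V → V → Fin t) → Set
  IsProper c = ∀ u v w → u ~ v → u ~ w → v ≢ w → c u v ≢ c u w

  -- A path or cycle with four edges: v0 v1 v2 v3 v4, consecutive vertices
  -- adjacent, v0..v3 pairwise distinct, v4 distinct from v1,v2,v3
  -- (v4 = v0 gives a 4-cycle, v4 ≠ v0 a path of length four).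
  record PathOrCycle4 : Set where
    field
      v0 v1 v2 v3 v4 : V
      a01 : v0 ~ v1
      a12 : v1 ~ v2
      a23 : v2 ~ v3
      a34 : v3 ~ v4
      d01 : v0 ≢ v1
      d02 : v0 ≢ v2
      d03 : v0 ≢ v3
      d12 : v1 ≢ v2
      d13 : v1 ≢ v3
      d23 : v2 ≢ v3
      d14 : v1 ≢ v4
      d24 : v2 ≢ v4
      d34 : v3 ≢ v4

  Bicoloured : (V → V → Fin t) → PathOrCycle4 → Set
  Bicoloured c P = ∃[ a ] ∃[ b ]
      ((c v0 v1 ≡ a ⊎ c v0 v1 ≡ b)
    × (c v1 v2 ≡ a ⊎ c v1 v2 ≡ b)
    × (c v2 v3 ≡ a ⊎ c v2 v3 ≡ b)
    × (c v3 v4 ≡ a ⊎ c v3 v4 ≡ b))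
    where open PathOrCycle4 P

  IsStarEdgeColouring : (V → V → Fin t) → Set
  IsStarEdgeColouring c =
    IsEdgeColouring c × IsProper c × (∀ (P : PathOrCycle4) → Bicoloured c P → ⊥)

  StarColourable : Set
  StarColourable = ∃[ c ] IsStarEdgeColouring c

StarChromaticIndex≡ : Graph → ℕ → Set
StarChromaticIndex≡ G k = StarColourable G k × (∀ t → StarColourable G t → k ≤ t)

-- In K_{2,d} let x j and y j be the colours of the edges from b_j to the two
-- vertices a₀, a₁ of the small side.  Every path or cycle with four edges is
-- b_i a b_j a′ b_k or a b_i a′ b_j a, so the colouring is a star edge colouring
-- iff x and y are injective, x j ≠ y j, and there is no chain x i = y j,
-- x j = y k.  Consequently, if a colour is used twice, as y j = x l, then x j
-- is used only once; counting gives 3d ≤ 2t, i.e. t ≥ ⌈3d/2⌉ = 2d − ⌊d/2⌋.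
-- Conversely, giving b_{2m}, b_{2m+1} the colours 3m, 3m+1 at a₀ and 3m+1, 3m+2
-- at a₁ is a star edge colouring with ⌈3d/2⌉ colours.
module Submission where

open import Defs
open import Data.Nat using (ℕ; _≤_; _*_; _∸_; _/_)

open import Data.Nat.Base using (zero; suc; _+_; _<_; z≤n; s≤s; ⌊_/2⌋; ⌈_/2⌉)
open import Data.Nat.Properties
  using ( module ≤-Reasoning; +-suc; +-comm; +-identityʳ; +-∸-assoc; m≤m+n; m+n∸m≡n
        ; +-mono-≤; +-mono-<-≤; <⇒≤; <-trans; <-cmp; n<1+n; 1+n≢n; ⌊n/2⌋-mono; ⌈n/2⌉-mono
        ; ⌊n/2⌋+⌈n/2⌉≡n; n≡⌈n+n/2⌉; <-irrefl)
  renaming (suc-injective to ℕ-suc-injective)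
open import Data.Nat.DivMod using (m/n≡1+[m∸n]/n)
open import Data.Fin.Base using (Fin; toℕ; fromℕ<)
open import Data.Fin.Properties
  using (_≟_; any?; suc-injective; toℕ-injective; toℕ<n; toℕ-fromℕ<; +↔⊎; injective⇒≤)
open import Data.Product using (∃-syntax; _,_; _×_; proj₁; proj₂)
open import Data.Sum using (_⊎_; inj₁; inj₂)
open import Data.Sum.Properties using (inj₁-injective; inj₂-injective)
open import Data.Sum.Function.Propositional using (_⊎-↔_)
open import Data.Empty using (⊥; ⊥-elim)
open import Function using (_∘_; _↣_; mk↣; Injection)
open import Function.Definitions using (Injective)
open import Function.Properties.Inverse using (↔-refl; ↔-sym; ↔-trans; ↔⇒↣)
open import Function.Properties.Injection using (↣-trans)
open import Relation.Nullary using (Dec; yes; no)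
open import Relation.Nullary.Decidable using (decidable-stable)
open import Relation.Binary.Definitions using (tri<; tri≈; tri>)
open import Relation.Binary.PropositionalEquality
  using (_≡_; _≢_; refl; sym; trans; cong; cong₂; subst; module ≡-Reasoning)

n/2≡⌊n/2⌋ : ∀ n → n / 2 ≡ ⌊ n /2⌋
n/2≡⌊n/2⌋ zero          = refl
n/2≡⌊n/2⌋ (suc zero)    = refl
n/2≡⌊n/2⌋ (suc (suc n)) =
  trans (m/n≡1+[m∸n]/n {suc (suc n)} {2} (s≤s (s≤s z≤n))) (cong suc (n/2≡⌊n/2⌋ n))

2*n∸n/2≡n+⌈n/2⌉ : ∀ n → 2 * n ∸ n / 2 ≡ n + ⌈ n /2⌉
2*n∸n/2≡n+⌈n/2⌉ n = begin
  2 * n ∸ n / 2                          ≡⟨ cong₂ _∸_ (cong (n +_) (+-identityʳ n)) (n/2≡⌊n/2⌋ n) ⟩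
  n + n ∸ ⌊ n /2⌋                        ≡⟨ cong (λ m → n + m ∸ ⌊ n /2⌋) (sym (⌊n/2⌋+⌈n/2⌉≡n n)) ⟩
  n + (⌊ n /2⌋ + ⌈ n /2⌉) ∸ ⌊ n /2⌋      ≡⟨ +-∸-assoc n (m≤m+n ⌊ n /2⌋ ⌈ n /2⌉) ⟩
  n + (⌊ n /2⌋ + ⌈ n /2⌉ ∸ ⌊ n /2⌋)      ≡⟨ cong (n +_) (m+n∸m≡n ⌊ n /2⌋ ⌈ n /2⌉) ⟩
  n + ⌈ n /2⌉                            ∎
  where open ≡-Reasoning

⌈[m+m]+n/2⌉≡m+⌈n/2⌉ : ∀ m n → ⌈ (m + m) + n /2⌉ ≡ m + ⌈ n /2⌉
⌈[m+m]+n/2⌉≡m+⌈n/2⌉ zero    n = refl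
⌈[m+m]+n/2⌉≡m+⌈n/2⌉ (suc m) n =
  trans (cong (λ k → ⌈ suc k + n /2⌉) (+-suc m m)) (cong suc (⌈[m+m]+n/2⌉≡m+⌈n/2⌉ m n))

n+n+n≤t+t⇒n+⌈n/2⌉≤t : ∀ n t → n + (n + n) ≤ t + t → n + ⌈ n /2⌉ ≤ t
n+n+n≤t+t⇒n+⌈n/2⌉≤t n t 3n≤2t = begin
  n + ⌈ n /2⌉        ≡⟨ sym (⌈[m+m]+n/2⌉≡m+⌈n/2⌉ n n) ⟩
  ⌈ (n + n) + n /2⌉  ≡⟨ cong ⌈_/2⌉ (+-comm (n + n) n) ⟩
  ⌈ n + (n + n) /2⌉  ≤⟨ ⌈n/2⌉-mono 3n≤2t ⟩
  ⌈ t + t /2⌉        ≡⟨ sym (n≡⌈n+n/2⌉ t) ⟩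
  t                  ∎
  where open ≤-Reasoning

-- x i, y i are the colours of the edges from the i-th vertex of the large side
-- of K_{2,d} to the two vertices of the small side; a chain x i = y j, x j = y k
-- is a bicoloured path (or, for i = k, 4-cycle) through them.
record IsStarPair {I C : Set} (x y : I → C) : Set where
  field
    x-injective : Injective _≡_ _≡_ x
    y-injective : Injective _≡_ _≡_ y
    x≢y         : ∀ i → x i ≢ y i
    no-chain    : ∀ i j k → x i ≡ y j → x j ≡ y k → ⊥

IsStarPair-pullback : ∀ {I I′ C C′ : Set} {x y : I → C} {x′ y′ : I′ → C′}
  (f : C → C′) {g : I → I′} → Injective _≡_ _≡_ g →
  (∀ i → f (x i) ≡ x′ (g i)) → (∀ i → f (y i) ≡ y′ (g i)) →
  IsStarPair x′ y′ → IsStarPair x y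
IsStarPair-pullback {x = x} {y} f {g} g-injective fx fy s = record
  { x-injective = λ {i} {j} e → g-injective (x-injective (along (fx i) (fx j) e))
  ; y-injective = λ {i} {j} e → g-injective (y-injective (along (fy i) (fy j) e))
  ; x≢y         = λ i e → x≢y (g i) (along (fx i) (fy i) e)
  ; no-chain    = λ i j k e₁ e₂ →
      no-chain (g i) (g j) (g k) (along (fx i) (fy j) e₁) (along (fx j) (fy k) e₂)
  }
  where
  open IsStarPair s
  along : ∀ {a b a′ b′} → f a ≡ a′ → f b ≡ b′ → a ≡ b → a′ ≡ b′
  along fa fb e = trans (sym fa) (trans (cong f e) fb)

module _ {d t : ℕ} {x y : Fin d → Fin t} (s : IsStarPair x y) where
  open IsStarPair s

  private
    IsXColour : Fin t → Set
    IsXColour c = ∃[ l ] x l ≡ c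

    -- A y-colour y j that is also an x-colour is counted through x j instead,
    -- which no-chain forbids from being a y-colour.
    third : (j : Fin d) → Dec (IsXColour (y j)) → Fin t ⊎ Fin t
    third j (yes _) = inj₂ (x j)
    third j (no _)  = inj₁ (y j)

    count : Fin d ⊎ (Fin d ⊎ Fin d) → Fin t ⊎ Fin t
    count (inj₁ j)        = inj₁ (x j)
    count (inj₂ (inj₁ j)) = inj₂ (y j)
    count (inj₂ (inj₂ j)) = third j (any? (λ l → x l ≟ y j))

    third-injective : ∀ {j k} p q → third j p ≡ third k q → j ≡ k
    third-injective (yes _) (yes _) e = x-injective (inj₂-injective e)
    third-injective (no _)  (no _)  e = y-injective (inj₁-injective e)

    x-colour≢third : ∀ j {k} p → inj₁ (x j) ≢ third k p
    x-colour≢third j (no ¬x) e = ¬x (j , inj₁-injective e)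

    y-colour≢third : ∀ j {k} p → inj₂ (y j) ≢ third k p
    y-colour≢third j (yes (l , xl≡yk)) e = no-chain l _ j xl≡yk (sym (inj₂-injective e))

    count-injective : Injective _≡_ _≡_ count
    count-injective {inj₁ j}        {inj₁ k}        e = cong inj₁ (x-injective (inj₁-injective e))
    count-injective {inj₁ j}        {inj₂ (inj₂ k)} e = ⊥-elim (x-colour≢third j _ e)
    count-injective {inj₂ (inj₁ j)} {inj₂ (inj₁ k)} e = cong (inj₂ ∘ inj₁) (y-injective (inj₂-injective e))
    count-injective {inj₂ (inj₁ j)} {inj₂ (inj₂ k)} e = ⊥-elim (y-colour≢third j _ e)
    count-injective {inj₂ (inj₂ j)} {inj₁ k}        e = ⊥-elim (x-colour≢third k _ (sym e))
    count-injective {inj₂ (inj₂ j)} {inj₂ (inj₁ k)} e = ⊥-elim (y-colour≢third k _ (sym e))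
    count-injective {inj₂ (inj₂ j)} {inj₂ (inj₂ k)} e = cong (inj₂ ∘ inj₂) (third-injective _ _ e)

    Fin3d↣Fin2t : Fin (d + (d + d)) ↣ Fin (t + t)
    Fin3d↣Fin2t =
      ↣-trans (↔⇒↣ (↔-trans +↔⊎ (↔-refl ⊎-↔ +↔⊎)))
        (↣-trans (mk↣ count-injective) (↔⇒↣ (↔-sym +↔⊎)))

  isStarPair⇒3d≤2t : d + (d + d) ≤ t + t
  isStarPair⇒3d≤2t = injective⇒≤ (Injection.injective Fin3d↣Fin2t)

threeHalves : ℕ → ℕ
threeHalves n = n + ⌊ n /2⌋

threeHalves-mono : ∀ {m n} → m ≤ n → threeHalves m ≤ threeHalves n
threeHalves-mono m≤n = +-mono-≤ m≤n (⌊n/2⌋-mono m≤n)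

threeHalves-strictMono : ∀ {m n} → m < n → threeHalves m < threeHalves n
threeHalves-strictMono m<n = +-mono-<-≤ m<n (⌊n/2⌋-mono (<⇒≤ m<n))

threeHalves-injective : Injective _≡_ _≡_ threeHalves
threeHalves-injective {m} {n} e with <-cmp m n
... | tri< m<n _ _ = ⊥-elim (<-irrefl e (threeHalves-strictMono m<n))
... | tri≈ _ m≡n _ = m≡n
... | tri> _ _ n<m = ⊥-elim (<-irrefl (sym e) (threeHalves-strictMono n<m))

threeHalves-suc-suc : ∀ n → threeHalves (suc (suc n)) ≡ 3 + threeHalves n
threeHalves-suc-suc n = cong (suc ∘ suc) (+-suc n ⌊ n /2⌋)

threeHalves≡suc⇒≡suc : ∀ m n → threeHalves m ≡ suc (threeHalves n) → m ≡ suc n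
threeHalves≡suc⇒≡suc m n e with <-cmp m (suc n)
... | tri≈ _ m≡1+n _ = m≡1+n
... | tri< (s≤s m≤n) _ _ = ⊥-elim (<-irrefl e (s≤s (threeHalves-mono m≤n)))
... | tri> _ _ 1+n<m = ⊥-elim (<-irrefl (sym e) (begin-strict
  suc (threeHalves n)          <⟨ n<1+n _ ⟩
  suc (suc (threeHalves n))    <⟨ n<1+n _ ⟩
  3 + threeHalves n            ≡⟨ sym (threeHalves-suc-suc n) ⟩
  threeHalves (suc (suc n))    ≤⟨ threeHalves-mono 1+n<m ⟩
  threeHalves m                ∎))
  where open ≤-Reasoning

isStarPair-threeHalves : IsStarPair threeHalves (suc ∘ threeHalves)
isStarPair-threeHalves = record
  { x-injective = threeHalves-injective
  ; y-injective = threeHalves-injective ∘ ℕ-suc-injective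
  ; x≢y         = λ n → 1+n≢n ∘ sym
  ; no-chain    = no-chain
  }
  where
  no-chain : ∀ i j k → threeHalves i ≡ suc (threeHalves j) →
             threeHalves j ≡ suc (threeHalves k) → ⊥
  no-chain i j k e₁ e₂ with threeHalves≡suc⇒≡suc i j e₁ | threeHalves≡suc⇒≡suc j k e₂
  ... | refl | refl = 1+n≢n (ℕ-suc-injective (ℕ-suc-injective (begin
    3 + threeHalves k              ≡⟨ sym (threeHalves-suc-suc k) ⟩
    threeHalves (suc (suc k))      ≡⟨ e₁ ⟩
    suc (threeHalves (suc k))      ≡⟨ cong suc e₂ ⟩
    2 + threeHalves k              ∎)))
    where open ≡-Reasoning

suc-threeHalves<n+⌈n/2⌉ : ∀ {j n} → j < n → suc (threeHalves j) < n + ⌈ n /2⌉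
suc-threeHalves<n+⌈n/2⌉ {j} {n} j<n = begin-strict
  suc (threeHalves j)        <⟨ n<1+n _ ⟩
  suc (suc (threeHalves j))  ≡⟨ cong suc (sym (+-suc j ⌊ j /2⌋)) ⟩
  suc j + ⌈ suc j /2⌉        ≤⟨ +-mono-≤ j<n (⌈n/2⌉-mono j<n) ⟩
  n + ⌈ n /2⌉                ∎
  where open ≤-Reasoning

module _ {d : ℕ} where
  optimalX optimalY : Fin d → Fin (d + ⌈ d /2⌉)
  optimalX j = fromℕ< (<-trans (n<1+n _) (suc-threeHalves<n+⌈n/2⌉ (toℕ<n j)))
  optimalY j = fromℕ< (suc-threeHalves<n+⌈n/2⌉ (toℕ<n j))

  isStarPair-optimal : IsStarPair optimalX optimalY
  isStarPair-optimal = IsStarPair-pullback toℕ toℕ-injective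
    (λ _ → toℕ-fromℕ< _) (λ _ → toℕ-fromℕ< _) isStarPair-threeHalves

pattern a₀  = Fin.zero
pattern a₁  = Fin.suc Fin.zero
pattern b j = Fin.suc (Fin.suc j)

module _ {d : ℕ} where
  private
    V : Set
    V = Fin (2 + d)

  data _~_ : V → V → Set where
    a₀~b : ∀ j → a₀ ~ b j
    a₁~b : ∀ j → a₁ ~ b j
    b~a₀ : ∀ j → b j ~ a₀
    b~a₁ : ∀ j → b j ~ a₁

  KAdj⇒~ : ∀ {u v} → KAdj 2 d u v → u ~ v
  KAdj⇒~ {a₀}  {b j} _ = a₀~b j
  KAdj⇒~ {a₁}  {b j} _ = a₁~b j
  KAdj⇒~ {b j} {a₀}  _ = b~a₀ j
  KAdj⇒~ {b j} {a₁}  _ = b~a₁ j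
  KAdj⇒~ {_}   {a₀}  (inj₁ (_ , ()))
  KAdj⇒~ {_}   {a₁}  (inj₁ (_ , s≤s ()))
  KAdj⇒~ {a₀}  {_}   (inj₂ (() , _))
  KAdj⇒~ {a₁}  {_}   (inj₂ (s≤s () , _))
  KAdj⇒~ {b _} {b _} (inj₁ (s≤s (s≤s ()) , _))
  KAdj⇒~ {b _} {b _} (inj₂ (_ , s≤s (s≤s ())))

  ~⇒KAdj : ∀ {u v} → u ~ v → KAdj 2 d u v
  ~⇒KAdj (a₀~b j) = inj₁ (s≤s z≤n , s≤s (s≤s z≤n))
  ~⇒KAdj (a₁~b j) = inj₁ (s≤s (s≤s z≤n) , s≤s (s≤s z≤n))
  ~⇒KAdj (b~a₀ j) = inj₂ (s≤s (s≤s z≤n) , s≤s z≤n)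
  ~⇒KAdj (b~a₁ j) = inj₂ (s≤s (s≤s z≤n) , s≤s (s≤s z≤n))

  data Shape : V → V → V → V → V → Set where
    path₀  : ∀ {i j k} → Shape (b i) a₀ (b j) a₁ (b k)
    path₁  : ∀ {i j k} → Shape (b i) a₁ (b j) a₀ (b k)
    cycle₀ : ∀ {i j} → Shape a₀ (b i) a₁ (b j) a₀
    cycle₁ : ∀ {i j} → Shape a₁ (b i) a₀ (b j) a₁

  shape : ∀ {v₀ v₁ v₂ v₃ v₄} → v₀ ~ v₁ → v₁ ~ v₂ → v₂ ~ v₃ → v₃ ~ v₄ →
          v₀ ≢ v₂ → v₁ ≢ v₃ → v₂ ≢ v₄ → Shape v₀ v₁ v₂ v₃ v₄
  shape (b~a₀ _) (a₀~b _) (b~a₁ _) (a₁~b _) _ _ _         = path₀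
  shape (b~a₁ _) (a₁~b _) (b~a₀ _) (a₀~b _) _ _ _         = path₁
  shape (a₀~b _) (b~a₁ _) (a₁~b _) (b~a₀ _) _ _ _         = cycle₀
  shape (a₁~b _) (b~a₀ _) (a₀~b _) (b~a₁ _) _ _ _         = cycle₁
  shape (b~a₀ _) (a₀~b _) (b~a₀ _) _        _ v₁≢v₃ _     = ⊥-elim (v₁≢v₃ refl)
  shape (b~a₁ _) (a₁~b _) (b~a₁ _) _        _ v₁≢v₃ _     = ⊥-elim (v₁≢v₃ refl)
  shape (a₀~b _) (b~a₀ _) _        _        v₀≢v₂ _ _     = ⊥-elim (v₀≢v₂ refl)
  shape (a₁~b _) (b~a₁ _) _        _        v₀≢v₂ _ _     = ⊥-elim (v₀≢v₂ refl)
  shape (a₀~b _) (b~a₁ _) (a₁~b _) (b~a₁ _) _ _ v₂≢v₄     = ⊥-elim (v₂≢v₄ refl)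
  shape (a₁~b _) (b~a₀ _) (a₀~b _) (b~a₀ _) _ _ v₂≢v₄     = ⊥-elim (v₂≢v₄ refl)

≢-common⇒≡ : ∀ {A : Set} {a b p q r : A} →
             (p ≡ a ⊎ p ≡ b) → (q ≡ a ⊎ q ≡ b) → (r ≡ a ⊎ r ≡ b) → p ≢ q → r ≢ q → p ≡ r
≢-common⇒≡ (inj₁ p≡a) (inj₁ q≡a) _          p≢q _   = ⊥-elim (p≢q (trans p≡a (sym q≡a)))
≢-common⇒≡ (inj₂ p≡b) (inj₂ q≡b) _          p≢q _   = ⊥-elim (p≢q (trans p≡b (sym q≡b)))
≢-common⇒≡ (inj₁ p≡a) (inj₂ _)   (inj₁ r≡a) _   _   = trans p≡a (sym r≡a)
≢-common⇒≡ (inj₂ p≡b) (inj₁ _)   (inj₂ r≡b) _   _   = trans p≡b (sym r≡b)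
≢-common⇒≡ (inj₁ _)   (inj₂ q≡b) (inj₂ r≡b) _   r≢q = ⊥-elim (r≢q (trans r≡b (sym q≡b)))
≢-common⇒≡ (inj₂ _)   (inj₁ q≡a) (inj₁ r≡a) _   r≢q = ⊥-elim (r≢q (trans r≡a (sym q≡a)))

module _ (G : Graph) (t : ℕ) {c : Fin (n G) → Fin (n G) → Fin t}
         (symmetric : IsEdgeColouring G t c) (proper : IsProper G t c) where

  consecutive-colours-≢ : ∀ {u v w} → Adj G u v → Adj G v w → u ≢ w → c u v ≢ c v w
  consecutive-colours-≢ {u} {v} {w} uv vw u≢w e =
    proper v u w (Adj-sym G uv) vw u≢w (trans (sym (symmetric u v uv)) e)

  bicoloured⇒alternating : (P : PathOrCycle4 G t) → Bicoloured G t c P →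
    let open PathOrCycle4 P in c v0 v1 ≡ c v2 v3 × c v1 v2 ≡ c v3 v4
  bicoloured⇒alternating P (_ , _ , m₀₁ , m₁₂ , m₂₃ , m₃₄) =
      ≢-common⇒≡ m₀₁ m₁₂ m₂₃ (consecutive-colours-≢ a01 a12 d02) (consecutive-colours-≢ a12 a23 d13 ∘ sym)
    , ≢-common⇒≡ m₁₂ m₂₃ m₃₄ (consecutive-colours-≢ a12 a23 d13) (consecutive-colours-≢ a23 a34 d24 ∘ sym)
    where open PathOrCycle4 P

module _ {d t : ℕ} where
  private
    V : Set
    V = Fin (2 + d)

  -- The colour z on non-adjacent pairs is arbitrary; it is what requires t ≠ 0.
  pairColouring : (x y : Fin d → Fin t) → Fin t → V → V → Fin t
  pairColouring x y z a₀    (b j) = x j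
  pairColouring x y z a₁    (b j) = y j
  pairColouring x y z (b j) a₀    = x j
  pairColouring x y z (b j) a₁    = y j
  pairColouring x y z _     _     = z

  module _ {x y : Fin d → Fin t} {z : Fin t} where
    pairColouring-symmetric : IsEdgeColouring (K 2 d) t (pairColouring x y z)
    pairColouring-symmetric u v uv with KAdj⇒~ uv
    ... | a₀~b _ = refl
    ... | a₁~b _ = refl
    ... | b~a₀ _ = refl
    ... | b~a₁ _ = refl

  module _ {x y : Fin d → Fin t} (s : IsStarPair x y) (z : Fin t) where
    open IsStarPair s
    private
      c : V → V → Fin t
      c = pairColouring x y z

    pairColouring-proper : IsProper (K 2 d) t c
    pairColouring-proper u v w uv uw v≢w with KAdj⇒~ uv | KAdj⇒~ uw
    ... | a₀~b _ | a₀~b _ = v≢w ∘ cong b ∘ x-injective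
    ... | a₁~b _ | a₁~b _ = v≢w ∘ cong b ∘ y-injective
    ... | b~a₀ i | b~a₁ _ = x≢y i
    ... | b~a₁ i | b~a₀ _ = x≢y i ∘ sym
    ... | b~a₀ _ | b~a₀ _ = ⊥-elim (v≢w refl)
    ... | b~a₁ _ | b~a₁ _ = ⊥-elim (v≢w refl)

    pairColouring-star : IsStarEdgeColouring (K 2 d) t c
    pairColouring-star = pairColouring-symmetric , pairColouring-proper , no-bicoloured
      where
      no-bicoloured : (P : PathOrCycle4 (K 2 d) t) → Bicoloured (K 2 d) t c P → ⊥
      no-bicoloured P bicoloured
        with bicoloured⇒alternating (K 2 d) t pairColouring-symmetric pairColouring-proper
               P bicoloured
           | shape (KAdj⇒~ a01) (KAdj⇒~ a12) (KAdj⇒~ a23) (KAdj⇒~ a34) d02 d13 d24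
        where open PathOrCycle4 P
      ... | e₁ , e₂ | path₀ {i} {j} {k} = no-chain i j k e₁ e₂
      ... | e₁ , e₂ | path₁ {i} {j} {k} = no-chain k j i (sym e₂) (sym e₁)
      ... | e₁ , e₂ | cycle₀ {i} {j}      = no-chain i j i e₁ (sym e₂)
      ... | e₁ , e₂ | cycle₁ {i} {j}      = no-chain j i j (sym e₁) e₂

  module _ {c : V → V → Fin t} (star : IsStarEdgeColouring (K 2 d) t c) where
    private
      symmetric : IsEdgeColouring (K 2 d) t c
      symmetric = proj₁ star
      proper : IsProper (K 2 d) t c
      proper = proj₁ (proj₂ star)
      no-bicoloured : ∀ P → Bicoloured (K 2 d) t c P → ⊥
      no-bicoloured = proj₂ (proj₂ star)

      b-injective : ∀ {i j : Fin d} → b i ≡ b j → i ≡ j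
      b-injective = suc-injective ∘ suc-injective

      x y : Fin d → Fin t
      x j = c a₀ (b j)
      y j = c a₁ (b j)

      centre-injective : ∀ {a} → (∀ j → a ~ b j) → Injective _≡_ _≡_ (λ j → c a (b j))
      centre-injective {a} a~b {i} {j} e = decidable-stable (i ≟ j) λ i≢j →
        proper a (b i) (b j) (~⇒KAdj (a~b i)) (~⇒KAdj (a~b j)) (i≢j ∘ b-injective) e

      x≢y : ∀ j → x j ≢ y j
      x≢y j e = consecutive-colours-≢ (K 2 d) t symmetric proper (~⇒KAdj (a₀~b j)) (~⇒KAdj (b~a₁ j)) (λ ())
        (trans e (symmetric a₁ (b j) (~⇒KAdj (a₁~b j))))

      no-chain : ∀ i j k → x i ≡ y j → x j ≡ y k → ⊥
      no-chain i j k xi≡yj xj≡yk = no-bicoloured P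
        ( x i , x j
        , inj₁ (symmetric (b i) a₀ (~⇒KAdj (b~a₀ i)))
        , inj₂ refl
        , inj₁ (trans (sym (symmetric a₁ (b j) (~⇒KAdj (a₁~b j)))) (sym xi≡yj))
        , inj₂ (sym xj≡yk) )
        where
        distinct : ∀ {i j} → x i ≡ y j → b i ≢ b j
        distinct xi≡yj bi≡bj = x≢y _ (trans xi≡yj (cong y (sym (b-injective bi≡bj))))
        P : PathOrCycle4 (K 2 d) t
        P = record
          { v0 = b i ; v1 = a₀ ; v2 = b j ; v3 = a₁ ; v4 = b k
          ; a01 = ~⇒KAdj (b~a₀ i) ; a12 = ~⇒KAdj (a₀~b j)
          ; a23 = ~⇒KAdj (b~a₁ j) ; a34 = ~⇒KAdj (a₁~b k)
          ; d01 = λ () ; d02 = distinct xi≡yj ; d03 = λ () ; d12 = λ () ; d13 = λ ()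
          ; d23 = λ () ; d14 = λ () ; d24 = distinct xj≡yk ; d34 = λ ()
          }

    starColouring⇒isStarPair : IsStarPair (λ j → c a₀ (b j)) (λ j → c a₁ (b j))
    starColouring⇒isStarPair = record
      { x-injective = centre-injective a₀~b
      ; y-injective = centre-injective a₁~b
      ; x≢y         = x≢y
      ; no-chain    = no-chain
      }

proposition2 : ∀ (d : ℕ) → 3 ≤ d → StarChromaticIndex≡ (K 2 d) (2 * d ∸ d / 2)
proposition2 zero    ()
proposition2 d@(suc _) _ = subst (StarChromaticIndex≡ (K 2 d)) (sym (2*n∸n/2≡n+⌈n/2⌉ d))
  ( (pairColouring optimalX optimalY z , pairColouring-star isStarPair-optimal z)
  , λ t (c , star) → n+n+n≤t+t⇒n+⌈n/2⌉≤t d t (isStarPair⇒3d≤2t (starColouring⇒isStarPair star)) )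
  where
  z : Fin (d + ⌈ d /2⌉)
  z = optimalX Fin.zero
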